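{- Let $q$ be an odd prime and $c \geq 0$ an integer. Then neither $2^c q^3$ nor $2^c q^5$ is pristine.
   Context: For positive integers, write $m \lfloor n$ to mean that $m$ is a proper divisor of $n$. The number of recursive divisors is defined by $a(1)=1$ and $a(n) = 1 + \sum_{m \lfloor n} a(m)$ for $n>1$. A positive integer $n$ is pristine if $a(n) = n$. -}

module Defs where

open import Data.Nat using (ℕ; zero; suc; _+_)
open import Data.Nat.Divisibility using (_∣?_)
open import Data.List using (List; map; filter; upTo; drop)
open import Data.Nat.ListAction using (sum)

properDivisors : ℕ → List ℕ
properDivisors n = filter (_∣? n) (drop 1 (upTo n))

-- Fuel-bounded recursion: with fuel f > (largest argument reached), the value
-- is the number of recursive divisors; fuel n suffices for argument n since
-- proper divisors are strictly smaller.
recDivF : ℕ → ℕ → ℕ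
recDivF zero    n = 0
recDivF (suc f) n = 1 + sum (map (recDivF f) (properDivisors n))

-- a(n): the number of recursive divisors, a(1) = 1, a(n) = 1 + Σ_{m ⌊ n} a(m).
recDiv : ℕ → ℕ
recDiv n = recDivF n n

Pristine : ℕ → Set
Pristine n = recDiv n ≡ n
  where open import Relation.Binary.PropositionalEquality using (_≡_)

private
  open import Relation.Binary.PropositionalEquality using (_≡_; refl)
  t1 : recDiv 1 ≡ 1
  t1 = refl
  t6 : recDiv 6 ≡ 6
  t6 = refl
  t48 : recDiv 40 ≡ 40
  t48 = refl
  t12 : recDiv 12 ≡ 16
  t12 = refl

-- Put a(i, j) = recDiv (2^i q^j). The divisors of 2^c q^k are the 2^i q^j with i ≤ c and
-- j ≤ k, so the defining recursion reads 2 a(c, k) = 1 + Σ_{i ≤ c, j ≤ k} a(i, j). Its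
-- second difference a(c+1, k+1) + 2 a(c, k) = 2 a(c, k+1) + 2 a(c+1, k), together with
-- a(c, 0) = 2^c, gives by induction on k closed forms k! a(c, k) = 2^c e_k(c) with
-- polynomials e_k; here e_3 = (c + 4)(c² + 11c + 12) and e_5 = (c + 6) b_5(c) with b_5 of
-- degree 4. If 2^c q^k is pristine then k! q^k = e_k(c). A prime dividing both factors
-- divides 16 (resp. 1024), so the odd prime power q^k divides one of them; it cannot be the
-- linear one, since the other factor exceeds k!. Hence the linear factor is at most k!,
-- i.e. c ≤ 2 (resp. c ≤ 114), and the remaining finitely many pairs (c, q) are excluded by
-- computation.

module Submission where

open import Defs
open import Data.Empty using (⊥)
open import Data.List using (List; []; _∷_; map; filter; applyUpTo; upTo; cartesianProductWith; _++_; _∷ʳ_)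
open import Data.List.Membership.Propositional using (_∈_)
open import Data.List.Membership.Propositional.Properties
  using (∈-filter⁻; ∈-filter⁺; ∈-applyUpTo⁺; ∈-applyUpTo⁻; ∈-upTo⁺; ∈-upTo⁻; ∈-cartesianProductWith⁺; ∈-cartesianProductWith⁻)
open import Data.List.Membership.Propositional.Properties.WithK using (unique∧set⇒bag)
open import Data.List.Properties using (map-cong; map-cong-local; map-++; map-∘; filter-++; filter-accept; applyUpTo-∷ʳ; upTo-∷ʳ)
open import Data.List.Relation.Binary.BagAndSetEquality using (∼bag⇒↭)
open import Data.List.Relation.Binary.Permutation.Propositional using (_↭_)
open import Data.List.Relation.Binary.Permutation.Propositional.Properties using (map⁺)
open import Data.List.Relation.Unary.All using (tabulate)
open import Data.List.Relation.Unary.Unique.Propositional using (Unique)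
import Data.List.Relation.Unary.Unique.Propositional.Properties as UniqueProp
open import Data.Nat.Base
open import Data.Nat.Coprimality using (Coprime; coprime-divisor)
open import Data.Nat.Divisibility
open import Data.Nat.ListAction using (sum)
open import Data.Nat.ListAction.Properties using (sum-++; sum-↭)
open import Data.Nat.Primality using (Prime; prime[2]; prime⇒irreducible; prime⇒nonZero; prime⇒nonTrivial; euclidsLemma)
open import Data.Nat.Properties
open import Algebra.Properties.CommutativeSemigroup *-commutativeSemigroup using (x∙yz≈y∙xz)
open import Data.Nat.Tactic.RingSolver using (solve; solve-∀)
open import Data.Product using (_×_; _,_; proj₁; proj₂; ∃-syntax)
open import Data.Sum using (inj₁; inj₂)
open import Function using (_∘_)
open import Function.Bundles using (mk⇔)
open import Relation.Binary.Definitions using (tri<; tri≈; tri>)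
open import Relation.Binary.PropositionalEquality
open import Relation.Nullary using (¬_; Dec; yes; no; contradiction)
open import Relation.Nullary.Decidable using (True; toWitness; _→-dec_)

divisors : ℕ → List ℕ
divisors n = filter (_∣? n) (applyUpTo suc n)

∈-properDivisors⁻ : ∀ {m n} → m ∈ properDivisors n → 0 < m × m < n
∈-properDivisors⁻ {n = suc k} m∈
  with _ , i<k , refl ← ∈-applyUpTo⁻ suc (proj₁ (∈-filter⁻ (_∣? suc k) {xs = applyUpTo suc k} m∈))
  = z<s , s<s i<k

recDivF-fuel : ∀ f g {n} → 0 < n → n ≤ f → n ≤ g → recDivF f n ≡ recDivF g n
recDivF-fuel zero    _       (s≤s z≤n) ()
recDivF-fuel (suc f) zero    (s≤s z≤n) _   ()
recDivF-fuel (suc f) (suc g) {n} _ n≤f n≤g =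
  cong (λ xs → 1 + sum xs) (map-cong-local (tabulate fuel-irrelevant))
  where
  fuel-irrelevant : ∀ {m} → m ∈ properDivisors n → recDivF f m ≡ recDivF g m
  fuel-irrelevant m∈ with 0<m , m<n ← ∈-properDivisors⁻ m∈ =
    recDivF-fuel f g 0<m (≤-pred (<-≤-trans m<n n≤f)) (≤-pred (<-≤-trans m<n n≤g))

recDiv-unfold : ∀ k → recDiv (suc k) ≡ 1 + sum (map recDiv (properDivisors (suc k)))
recDiv-unfold k = cong (λ xs → 1 + sum xs) (map-cong-local (tabulate enough-fuel))
  where
  enough-fuel : ∀ {m} → m ∈ properDivisors (suc k) → recDivF k m ≡ recDiv m
  enough-fuel m∈ with 0<m , m<n ← ∈-properDivisors⁻ m∈ = recDivF-fuel k _ 0<m (≤-pred m<n) ≤-refl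

divisors-∷ʳ : ∀ k → divisors (suc k) ≡ properDivisors (suc k) ∷ʳ suc k
divisors-∷ʳ k = begin
  filter P? (applyUpTo suc (suc k))               ≡⟨ cong (filter P?) (applyUpTo-∷ʳ suc k) ⟨
  filter P? (applyUpTo suc k ∷ʳ suc k)            ≡⟨ filter-++ P? (applyUpTo suc k) _ ⟩
  filter P? (applyUpTo suc k) ++ filter P? (suc k ∷ []) ≡⟨ cong (filter P? (applyUpTo suc k) ++_) (filter-accept P? ∣-refl) ⟩
  properDivisors (suc k) ∷ʳ suc k                 ∎
  where
  open ≡-Reasoning
  P? : ∀ m → Dec (m ∣ suc k)
  P? = _∣? suc k

sum-recDiv-divisors : ∀ k → sum (map recDiv (divisors (suc k))) ≡ sum (map recDiv (properDivisors (suc k))) + recDiv (suc k)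
sum-recDiv-divisors k = begin
  sum (map recDiv (divisors (suc k)))                ≡⟨ cong (λ xs → sum (map recDiv xs)) (divisors-∷ʳ k) ⟩
  sum (map recDiv (proper ++ suc k ∷ []))            ≡⟨ cong sum (map-++ recDiv proper _) ⟩
  sum (map recDiv proper ++ recDiv (suc k) ∷ [])     ≡⟨ sum-++ (map recDiv proper) _ ⟩
  sum (map recDiv proper) + (recDiv (suc k) + 0)     ≡⟨ cong (sum (map recDiv proper) +_) (+-identityʳ _) ⟩
  sum (map recDiv proper) + recDiv (suc k)           ∎
  where
  open ≡-Reasoning
  proper : List ℕ
  proper = properDivisors (suc k)

recDiv-sum-divisors : ∀ n .{{_ : NonZero n}} {ds} → divisors n ↭ ds → 2 * recDiv n ≡ 1 + sum (map recDiv ds)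
recDiv-sum-divisors (suc k) {ds} divisors↭ds = begin
  2 * a                                            ≡⟨ cong (a +_) (+-identityʳ a) ⟩
  a + a                                            ≡⟨ cong (_+ a) (recDiv-unfold k) ⟩
  1 + (sum (map recDiv (properDivisors (suc k))) + a) ≡⟨ cong suc (sum-recDiv-divisors k) ⟨
  1 + sum (map recDiv (divisors (suc k)))          ≡⟨ cong suc (sum-↭ (map⁺ recDiv divisors↭ds)) ⟩
  1 + sum (map recDiv ds)                          ∎
  where
  open ≡-Reasoning
  a : ℕ
  a = recDiv (suc k)

sum< : ℕ → (ℕ → ℕ) → ℕ
sum< zero    f = 0
sum< (suc n) f = sum< n f + f n

sum-map-upTo : ∀ (f : ℕ → ℕ) n → sum (map f (upTo n)) ≡ sum< n f
sum-map-upTo f zero    = refl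
sum-map-upTo f (suc n) = begin
  sum (map f (upTo (suc n)))         ≡⟨ cong (λ xs → sum (map f xs)) (upTo-∷ʳ n) ⟨
  sum (map f (upTo n ++ n ∷ []))     ≡⟨ cong sum (map-++ f (upTo n) _) ⟩
  sum (map f (upTo n) ++ f n ∷ [])   ≡⟨ sum-++ (map f (upTo n)) _ ⟩
  sum (map f (upTo n)) + (f n + 0)   ≡⟨ cong₂ _+_ (sum-map-upTo f n) (+-identityʳ (f n)) ⟩
  sum< n f + f n                     ∎
  where open ≡-Reasoning

sum-cartesianProductWith : ∀ (g : ℕ → ℕ) (h : ℕ → ℕ → ℕ) xs ys →
  sum (map g (cartesianProductWith h xs ys)) ≡ sum (map (λ x → sum (map (λ y → g (h x y)) ys)) xs)
sum-cartesianProductWith g h []       ys = refl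
sum-cartesianProductWith g h (x ∷ xs) ys = begin
  sum (map g (map (h x) ys ++ cartesianProductWith h xs ys))
    ≡⟨ cong sum (map-++ g (map (h x) ys) _) ⟩
  sum (map g (map (h x) ys) ++ map g (cartesianProductWith h xs ys))
    ≡⟨ sum-++ (map g (map (h x) ys)) _ ⟩
  sum (map g (map (h x) ys)) + sum (map g (cartesianProductWith h xs ys))
    ≡⟨ cong₂ _+_ (cong sum (sym (map-∘ ys))) (sum-cartesianProductWith g h xs ys) ⟩
  sum (map (λ y → g (h x y)) ys) + sum (map (λ x → sum (map (λ y → g (h x y)) ys)) xs) ∎
  where open ≡-Reasoning

RecDivTable : (ℕ → ℕ → ℕ) → Set
RecDivTable a = ∀ i j → 2 * a i j ≡ 1 + sum< (suc i) (λ i′ → sum< (suc j) (a i′))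

2*x≡y+x⇒x≡y : ∀ {x y} → 2 * x ≡ y + x → x ≡ y
2*x≡y+x⇒x≡y {x} {y} 2x≡y+x = +-cancelʳ-≡ x x y (trans (cong (x +_) (sym (+-identityʳ x))) 2x≡y+x)

module _ {a : ℕ → ℕ → ℕ} (table : RecDivTable a) where

  table-corner : a 0 0 ≡ 1
  table-corner = 2*x≡y+x⇒x≡y (table 0 0)

  table-step : ∀ i j → 2 * a (suc i) j ≡ 2 * a i j + sum< (suc j) (a (suc i))
  table-step i j = trans (table (suc i) j) (cong (_+ sum< (suc j) (a (suc i))) (sym (table i j)))

  table-edgeˡ : ∀ i → a (suc i) 0 ≡ 2 * a i 0
  table-edgeˡ i = 2*x≡y+x⇒x≡y (table-step i 0)

  table-edgeʳ : ∀ j → a 0 (suc j) ≡ 2 * a 0 j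
  table-edgeʳ j = 2*x≡y+x⇒x≡y (trans (table 0 (suc j)) (cong (_+ a 0 (suc j)) (sym (table 0 j))))

  table-local : ∀ i j → a (suc i) (suc j) + 2 * a i j ≡ 2 * a i (suc j) + 2 * a (suc i) j
  table-local i j = begin
    a (suc i) (suc j) + 2 * a i j        ≡⟨ cong (_+ 2 * a i j) diagonal ⟩
    2 * a i (suc j) + R + 2 * a i j      ≡⟨ +-assoc (2 * a i (suc j)) R _ ⟩
    2 * a i (suc j) + (R + 2 * a i j)    ≡⟨ cong (2 * a i (suc j) +_) (+-comm R _) ⟩
    2 * a i (suc j) + (2 * a i j + R)    ≡⟨ cong (2 * a i (suc j) +_) (table-step i j) ⟨
    2 * a i (suc j) + 2 * a (suc i) j    ∎
    where
    open ≡-Reasoning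
    R : ℕ
    R = sum< (suc j) (a (suc i))
    diagonal : a (suc i) (suc j) ≡ 2 * a i (suc j) + R
    diagonal = 2*x≡y+x⇒x≡y (trans (table-step i (suc j)) (sym (+-assoc (2 * a i (suc j)) R _)))

-- Divisors of p^c q^k

∈-divisors⁻ : ∀ {n x} → x ∈ divisors n → x ∣ n
∈-divisors⁻ {n} x∈ = proj₂ (∈-filter⁻ (_∣? n) {xs = applyUpTo suc n} x∈)

∈-divisors⁺ : ∀ {n x} .{{_ : NonZero n}} → x ∣ n → x ∈ divisors n
∈-divisors⁺ {n} {zero}  0∣n = contradiction (0∣⇒≡0 0∣n) (≢-nonZero⁻¹ n)
∈-divisors⁺ {n} {suc _} x∣n = ∈-filter⁺ (_∣? n) (∈-applyUpTo⁺ suc (∣⇒≤ x∣n)) x∣n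

divisors-unique : ∀ n → Unique (divisors n)
divisors-unique n = UniqueProp.filter⁺ (_∣? n) (UniqueProp.applyUpTo⁺₁ suc n (λ i<j _ → <⇒≢ (s<s i<j)))

^-injectiveʳ : ∀ {m i j} → 1 < m → m ^ i ≡ m ^ j → i ≡ j
^-injectiveʳ {m} {i} {j} 1<m m^i≡m^j with <-cmp i j
... | tri< i<j _ _ = contradiction m^i≡m^j (<⇒≢ (^-monoʳ-< m 1<m i<j))
... | tri≈ _ i≡j _ = i≡j
... | tri> _ _ j<i = contradiction (sym m^i≡m^j) (<⇒≢ (^-monoʳ-< m 1<m j<i))

^-monoʳ-∣ : ∀ m {i j} → i ≤ j → m ^ i ∣ m ^ j
^-monoʳ-∣ m {i} i≤j with o , refl ← m≤n⇒∃[o]m+o≡n i≤j = divides (m ^ o) (trans (^-distribˡ-+-* m i o) (*-comm (m ^ i) (m ^ o)))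

module _ {p : ℕ} (p-prime : Prime p) where

  private instance
    p≢0 : NonZero p
    p≢0 = prime⇒nonZero p-prime

  prime≢1 : p ≢ 1
  prime≢1 = nonTrivial⇒≢1 {{prime⇒nonTrivial p-prime}}

  ∤⇒coprime : ∀ {x} → ¬ p ∣ x → Coprime x p
  ∤⇒coprime p∤x (d∣x , d∣p) with prime⇒irreducible p-prime d∣p
  ... | inj₁ d≡1 = d≡1
  ... | inj₂ refl = contradiction d∣x p∤x

  ∣prime^⇒≡ : ∀ {q} n → Prime q → p ∣ q ^ n → p ≡ q
  ∣prime^⇒≡ zero    _       p∣1 = contradiction (∣1⇒≡1 p∣1) prime≢1
  ∣prime^⇒≡ {q} (suc n) q-prime p∣q^n+1 with euclidsLemma q (q ^ n) p-prime p∣q^n+1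
  ... | inj₂ p∣q^n = ∣prime^⇒≡ n q-prime p∣q^n
  ... | inj₁ p∣q with prime⇒irreducible q-prime p∣q
  ...   | inj₁ p≡1 = contradiction p≡1 prime≢1
  ...   | inj₂ p≡q = p≡q

  p*p^c*m≡p^c*m*p : ∀ c m → p * p ^ c * m ≡ p ^ c * m * p
  p*p^c*m≡p^c*m*p c m = trans (*-assoc p (p ^ c) m) (*-comm p (p ^ c * m))

  ∣p^c*m⇒ : ∀ c {m x} → x ∣ p ^ c * m → ∃[ i ] ∃[ y ] (i ≤ c × y ∣ m × x ≡ p ^ i * y)
  ∣p^c*m⇒ zero {m} {x} x∣m = 0 , x , z≤n , subst (x ∣_) (+-identityʳ m) x∣m , sym (+-identityʳ x)
  ∣p^c*m⇒ (suc c) {m} {x} x∣ with p ∣? x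
  ... | yes (divides z refl)
    with i , y , i≤c , y∣m , refl ← ∣p^c*m⇒ c {x = z} (*-cancelʳ-∣ p (subst (z * p ∣_) (p*p^c*m≡p^c*m*p c m) x∣))
    = suc i , y , s≤s i≤c , y∣m , sym (p*p^c*m≡p^c*m*p i y)
  ... | no p∤x
    with i , y , i≤c , y∣m , x≡ ← ∣p^c*m⇒ c (coprime-divisor (∤⇒coprime p∤x) (subst (x ∣_) (*-assoc p (p ^ c) m) x∣))
    = i , y , m≤n⇒m≤1+n i≤c , y∣m , x≡

  ∣p^c⇒ : ∀ c {x} → x ∣ p ^ c → ∃[ i ] (i ≤ c × x ≡ p ^ i)
  ∣p^c⇒ c {x} x∣p^c with i , y , i≤c , y∣1 , refl ← ∣p^c*m⇒ c (subst (x ∣_) (sym (*-identityʳ (p ^ c))) x∣p^c)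
    rewrite ∣1⇒≡1 y∣1 = i , i≤c , *-identityʳ (p ^ i)

  ∤⇒^-coprime : ∀ k {b} → ¬ p ∣ b → Coprime (p ^ k) b
  ∤⇒^-coprime k p∤b (d∣p^k , d∣b) with ∣p^c⇒ k d∣p^k
  ... | zero  , _ , d≡1  = d≡1
  ... | suc i , _ , refl = contradiction (∣-trans (m∣m*n (p ^ i)) d∣b) p∤b

  factor≤ : ∀ M k A B → M * p ^ k ≡ A * B → M < B → 0 < A → (p ∣ A → p ∣ B → ⊥) → A ≤ M
  factor≤ M k A B eq M<B 0<A not-both with p ∣? A
  ... | yes p∣A = contradiction eq (<⇒≢ (begin-strict
    M * p ^ k   <⟨ *-monoˡ-< (p ^ k) {{m^n≢0 p k}} M<B ⟩
    B * p ^ k   ≤⟨ *-monoʳ-≤ B (∣⇒≤ {{>-nonZero 0<A}} p^k∣A) ⟩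
    B * A       ≡⟨ *-comm B A ⟩
    A * B       ∎))
    where
    open ≤-Reasoning
    p^k∣A : p ^ k ∣ A
    p^k∣A = coprime-divisor (∤⇒^-coprime k (not-both p∣A)) (subst (p ^ k ∣_) (trans eq (*-comm A B)) (n∣m*n M))
  ... | no p∤A = *-cancelʳ-≤ A M (p ^ k) {{m^n≢0 p k}} (begin
    A * p ^ k   ≤⟨ *-monoʳ-≤ A (∣⇒≤ {{>-nonZero (<-≤-trans z<s M<B)}} p^k∣B) ⟩
    A * B       ≡⟨ eq ⟨
    M * p ^ k   ∎)
    where
    open ≤-Reasoning
    p^k∣B : p ^ k ∣ B
    p^k∣B = coprime-divisor (∤⇒^-coprime k p∤A) (subst (p ^ k ∣_) eq (n∣m*n M))

module _ {p q : ℕ} (p-prime : Prime p) (q-prime : Prime q) (p≢q : p ≢ q) where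

  private instance
    p≢0 : NonZero p
    p≢0 = prime⇒nonZero p-prime
    q≢0 : NonZero q
    q≢0 = prime⇒nonZero q-prime

  p^*q^≢0 : ∀ i j → NonZero (p ^ i * q ^ j)
  p^*q^≢0 i j = m*n≢0 (p ^ i) (q ^ j) {{m^n≢0 p i}} {{m^n≢0 q j}}

  p∤q^ : ∀ j → ¬ p ∣ q ^ j
  p∤q^ j p∣q^j = p≢q (∣prime^⇒≡ p-prime j q-prime p∣q^j)

  p^*q^-injective : ∀ {i i′ j j′} → p ^ i * q ^ j ≡ p ^ i′ * q ^ j′ → i ≡ i′ × j ≡ j′
  p^*q^-injective {zero} {zero} eq =
    refl , ^-injectiveʳ (nonTrivial⇒n>1 q {{prime⇒nonTrivial q-prime}}) (*-cancelˡ-≡ _ _ 1 eq)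
  p^*q^-injective {zero} {suc i′} {j} eq =
    contradiction (subst (p ∣_) (trans (sym eq) (*-identityˡ _)) (∣-trans (m∣m*n (p ^ i′)) (m∣m*n _))) (p∤q^ j)
  p^*q^-injective {suc i} {zero} {_} {j′} eq =
    contradiction (subst (p ∣_) (trans eq (*-identityˡ _)) (∣-trans (m∣m*n (p ^ i)) (m∣m*n _))) (p∤q^ j′)
  p^*q^-injective {suc i} {suc i′} eq
    with i≡i′ , j≡j′ ← p^*q^-injective {i} {i′} (*-cancelˡ-≡ _ _ p (trans (sym (*-assoc p _ _)) (trans eq (*-assoc p _ _))))
    = cong suc i≡i′ , j≡j′

  divisors-p^*q^ : ∀ c k →
    divisors (p ^ c * q ^ k) ↭ cartesianProductWith (λ i j → p ^ i * q ^ j) (upTo (suc c)) (upTo (suc k))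
  divisors-p^*q^ c k = ∼bag⇒↭ (unique∧set⇒bag (divisors-unique n) products-unique (mk⇔ to from))
    where
    n : ℕ
    n = p ^ c * q ^ k
    instance
      n≢0 : NonZero n
      n≢0 = p^*q^≢0 c k
    products : List ℕ
    products = cartesianProductWith (λ i j → p ^ i * q ^ j) (upTo (suc c)) (upTo (suc k))
    products-unique : Unique products
    products-unique = UniqueProp.cartesianProductWith⁺ _ p^*q^-injective (UniqueProp.upTo⁺ (suc c)) (UniqueProp.upTo⁺ (suc k))
    to : ∀ {x} → x ∈ divisors n → x ∈ products
    to x∈ with i , y , i≤c , y∣q^k , refl ← ∣p^c*m⇒ p-prime c (∈-divisors⁻ x∈)
          with j , j≤k , refl ← ∣p^c⇒ q-prime k y∣q^k
      = ∈-cartesianProductWith⁺ _ (∈-upTo⁺ (s≤s i≤c)) (∈-upTo⁺ (s≤s j≤k))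
    from : ∀ {x} → x ∈ products → x ∈ divisors n
    from x∈ with i , j , i∈ , j∈ , refl ← ∈-cartesianProductWith⁻ _ (upTo (suc c)) (upTo (suc k)) x∈
      = ∈-divisors⁺ (*-pres-∣ (^-monoʳ-∣ p (≤-pred (∈-upTo⁻ i∈))) (^-monoʳ-∣ q (≤-pred (∈-upTo⁻ j∈))))

  recDiv-p^*q^-table : RecDivTable (λ i j → recDiv (p ^ i * q ^ j))
  recDiv-p^*q^-table c k = begin
    2 * recDiv (p ^ c * q ^ k)
      ≡⟨ recDiv-sum-divisors (p ^ c * q ^ k) (divisors-p^*q^ c k) ⟩
    1 + sum (map recDiv (cartesianProductWith p^*q^ (upTo (suc c)) (upTo (suc k))))
      ≡⟨ cong suc (sum-cartesianProductWith recDiv p^*q^ (upTo (suc c)) (upTo (suc k))) ⟩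
    1 + sum (map (λ i → sum (map (λ j → recDiv (p^*q^ i j)) (upTo (suc k)))) (upTo (suc c)))
      ≡⟨ cong (λ xs → 1 + sum xs) (map-cong (λ i → sum-map-upTo (λ j → recDiv (p^*q^ i j)) (suc k)) (upTo (suc c))) ⟩
    1 + sum (map (λ i → sum< (suc k) (λ j → recDiv (p^*q^ i j))) (upTo (suc c)))
      ≡⟨ cong suc (sum-map-upTo (λ i → sum< (suc k) (λ j → recDiv (p^*q^ i j))) (suc c)) ⟩
    1 + sum< (suc c) (λ i → sum< (suc k) (λ j → recDiv (p^*q^ i j))) ∎
    where
    open ≡-Reasoning
    p^*q^ : ℕ → ℕ → ℕ
    p^*q^ i j = p ^ i * q ^ j
    instance
      n≢0 : NonZero (p ^ c * q ^ k)
      n≢0 = p^*q^≢0 c k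

-- Polynomials with natural coefficients, as coefficient lists

horner : List ℕ → ℕ → ℕ
horner []       x = 0
horner (a ∷ as) x = a + x * horner as x

infixl 6 _⊕_
infixl 7 _⊛_ _⊗_

_⊕_ : List ℕ → List ℕ → List ℕ
[]       ⊕ Q        = Q
(a ∷ P)  ⊕ []       = a ∷ P
(a ∷ P)  ⊕ (b ∷ Q)  = a + b ∷ P ⊕ Q

_⊛_ : ℕ → List ℕ → List ℕ
k ⊛ []      = []
k ⊛ (a ∷ P) = k * a ∷ k ⊛ P

_⊗_ : List ℕ → List ℕ → List ℕ
[]      ⊗ Q = []
(a ∷ P) ⊗ Q = a ⊛ Q ⊕ (0 ∷ P ⊗ Q)

translate : List ℕ → List ℕ
translate []      = []
translate (a ∷ P) = (a ∷ translate P) ⊕ translate P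

horner-⊕ : ∀ P Q x → horner (P ⊕ Q) x ≡ horner P x + horner Q x
horner-⊕ []      Q       x = refl
horner-⊕ (a ∷ P) []      x = sym (+-identityʳ _)
horner-⊕ (a ∷ P) (b ∷ Q) x = trans (cong (λ t → a + b + x * t) (horner-⊕ P Q x)) (interchange a b x _ _)
  where
  interchange : ∀ a b x u v → a + b + x * (u + v) ≡ a + x * u + (b + x * v)
  interchange = solve-∀

horner-⊛ : ∀ k P x → horner (k ⊛ P) x ≡ k * horner P x
horner-⊛ k []      x = sym (*-zeroʳ k)
horner-⊛ k (a ∷ P) x = trans (cong (λ t → k * a + x * t) (horner-⊛ k P x)) (factor k a x _)
  where
  factor : ∀ k a x u → k * a + x * (k * u) ≡ k * (a + x * u)
  factor = solve-∀

horner-⊗ : ∀ P Q x → horner (P ⊗ Q) x ≡ horner P x * horner Q x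
horner-⊗ []      Q x = refl
horner-⊗ (a ∷ P) Q x = begin
  horner (a ⊛ Q ⊕ (0 ∷ P ⊗ Q)) x                ≡⟨ horner-⊕ (a ⊛ Q) (0 ∷ P ⊗ Q) x ⟩
  horner (a ⊛ Q) x + x * horner (P ⊗ Q) x       ≡⟨ cong₂ (λ s t → s + x * t) (horner-⊛ a Q x) (horner-⊗ P Q x) ⟩
  a * horner Q x + x * (horner P x * horner Q x) ≡⟨ distrib a x (horner P x) (horner Q x) ⟩
  (a + x * horner P x) * horner Q x             ∎
  where
  open ≡-Reasoning
  distrib : ∀ a x u v → a * v + x * (u * v) ≡ (a + x * u) * v
  distrib = solve-∀

horner-translate : ∀ P x → horner (translate P) x ≡ horner P (suc x)
horner-translate []      x = refl
horner-translate (a ∷ P) x = begin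
  horner ((a ∷ translate P) ⊕ translate P) x         ≡⟨ horner-⊕ (a ∷ translate P) (translate P) x ⟩
  a + x * horner (translate P) x + horner (translate P) x ≡⟨ cong (λ t → a + x * t + t) (horner-translate P x) ⟩
  a + x * horner P (suc x) + horner P (suc x)        ≡⟨ collect a x (horner P (suc x)) ⟩
  a + suc x * horner P (suc x)                       ∎
  where
  open ≡-Reasoning
  collect : ∀ a x u → a + x * u + u ≡ a + suc x * u
  collect = solve-∀

horner-mono : ∀ P {x y} → x ≤ y → horner P x ≤ horner P y
horner-mono []      x≤y = z≤n
horner-mono (a ∷ P) x≤y = +-monoʳ-≤ a (*-mono-≤ x≤y (horner-mono P x≤y))

horner-constant : ∀ k x → horner (k ∷ []) x ≡ k
horner-constant k x = trans (cong (k +_) (*-zeroʳ x)) (+-identityʳ k)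

horner-linear : ∀ k x → horner (k ∷ 1 ∷ []) x ≡ k + x
horner-linear k x = cong (k +_) (trans (cong (x *_) (horner-constant 1 x)) (*-identityʳ x))

horner-cong : ∀ {P Q} → P ≡ Q → ∀ x → horner P x ≡ horner Q x
horner-cong P≡Q x = cong (λ R → horner R x) P≡Q

-- Closed forms of the first columns

record ClosedColumn (a : ℕ → ℕ → ℕ) (j : ℕ) (P : List ℕ) : Set where
  constructor closedColumn
  field closed : ∀ c → j ! * a c j ≡ 2 ^ c * horner P c

open ClosedColumn

column-induction-step : ∀ {m K e x y z w P₀ P₁ Q₀ Q₁} →
  x + 2 * y ≡ 2 * z + 2 * w → K * y ≡ e * P₀ → m * K * z ≡ e * Q₀ → K * w ≡ 2 * e * P₁ →
  Q₁ + m * P₀ ≡ Q₀ + 2 * m * P₁ → m * K * x ≡ 2 * e * Q₁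
column-induction-step {m} {K} {e} {x} {y} {z} {w} {P₀} {P₁} {Q₀} {Q₁} local hy hz hw shift =
  +-cancelʳ-≡ (2 * m * (e * P₀)) _ _ (begin
    m * K * x + 2 * m * (e * P₀)        ≡⟨ cong (λ t → m * K * x + 2 * m * t) hy ⟨
    m * K * x + 2 * m * (K * y)         ≡⟨ solve (m ∷ K ∷ x ∷ y ∷ []) ⟩
    m * K * (x + 2 * y)                 ≡⟨ cong (m * K *_) local ⟩
    m * K * (2 * z + 2 * w)             ≡⟨ solve (m ∷ K ∷ z ∷ w ∷ []) ⟩
    2 * (m * K * z) + 2 * m * (K * w)   ≡⟨ cong₂ (λ s t → 2 * s + 2 * m * t) hz hw ⟩
    2 * (e * Q₀) + 2 * m * (2 * e * P₁) ≡⟨ solve (m ∷ e ∷ Q₀ ∷ P₁ ∷ []) ⟩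
    2 * e * (Q₀ + 2 * m * P₁)           ≡⟨ cong (2 * e *_) shift ⟨
    2 * e * (Q₁ + m * P₀)               ≡⟨ solve (m ∷ e ∷ Q₁ ∷ P₀ ∷ []) ⟩
    2 * e * Q₁ + 2 * m * (e * P₀)       ∎)
  where open ≡-Reasoning

column-induction-base : ∀ {m K x y P₀ Q₀} → x ≡ 2 * y → K * y ≡ 1 * P₀ → Q₀ ≡ 2 * m * P₀ → m * K * x ≡ 1 * Q₀
column-induction-base {m} {K} {x} {y} {P₀} {Q₀} x≡2y hy base = begin
  m * K * x          ≡⟨ cong (m * K *_) x≡2y ⟩
  m * K * (2 * y)    ≡⟨ solve (m ∷ K ∷ y ∷ []) ⟩
  2 * m * (K * y)    ≡⟨ cong (2 * m *_) hy ⟩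
  2 * m * (1 * P₀)   ≡⟨ solve (m ∷ P₀ ∷ []) ⟩
  2 * m * P₀         ≡⟨ base ⟨
  Q₀                 ≡⟨ *-identityˡ Q₀ ⟨
  1 * Q₀             ∎
  where open ≡-Reasoning

translation-identity : ∀ {m P Q} → translate Q ⊕ m ⊛ P ≡ Q ⊕ 2 * m ⊛ translate P →
  ∀ x → horner Q (suc x) + m * horner P x ≡ horner Q x + 2 * m * horner P (suc x)
translation-identity {m} {P} {Q} identity x = begin
  horner Q (suc x) + m * horner P x                  ≡⟨ cong₂ _+_ (horner-translate Q x) (horner-⊛ m P x) ⟨
  horner (translate Q) x + horner (m ⊛ P) x          ≡⟨ horner-⊕ (translate Q) (m ⊛ P) x ⟨
  horner (translate Q ⊕ m ⊛ P) x                     ≡⟨ horner-cong identity x ⟩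
  horner (Q ⊕ 2 * m ⊛ translate P) x                 ≡⟨ horner-⊕ Q (2 * m ⊛ translate P) x ⟩
  horner Q x + horner (2 * m ⊛ translate P) x        ≡⟨ cong (horner Q x +_) (horner-⊛ (2 * m) (translate P) x) ⟩
  horner Q x + 2 * m * horner (translate P) x        ≡⟨ cong (λ t → horner Q x + 2 * m * t) (horner-translate P x) ⟩
  horner Q x + 2 * m * horner P (suc x)              ∎
  where open ≡-Reasoning

e₀ e₁ e₂ e₃ e₄ e₅ : List ℕ
e₀ = 1 ∷ []
e₁ = 2 ∷ 1 ∷ []
e₂ = 8 ∷ 7 ∷ 1 ∷ []
e₃ = 48 ∷ 56 ∷ 15 ∷ 1 ∷ []
e₄ = 384 ∷ 538 ∷ 203 ∷ 26 ∷ 1 ∷ []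
e₅ = 3840 ∷ 6124 ∷ 2900 ∷ 535 ∷ 40 ∷ 1 ∷ []

module _ {a : ℕ → ℕ → ℕ} (table : RecDivTable a) where

  table-column-zero : ∀ c → a c 0 ≡ 2 ^ c
  table-column-zero zero    = table-corner table
  table-column-zero (suc c) = trans (table-edgeˡ table c) (cong (2 *_) (table-column-zero c))

  closedColumn-zero : ClosedColumn a 0 e₀
  closedColumn-zero = closedColumn λ c → begin
    1 * a c 0            ≡⟨ *-identityˡ _ ⟩
    a c 0                ≡⟨ table-column-zero c ⟩
    2 ^ c                ≡⟨ *-identityʳ _ ⟨
    2 ^ c * 1            ≡⟨ cong (2 ^ c *_) (horner-constant 1 c) ⟨
    2 ^ c * horner e₀ c  ∎
    where open ≡-Reasoning

  -- The coefficient identity says Q(x + 1) + (j + 1) P(x) = Q(x) + 2 (j + 1) P(x + 1): it is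
  -- table-local with the columns j, j + 1 replaced by their closed forms.
  closedColumn-suc : ∀ {j P Q} → ClosedColumn a j P →
    translate Q ⊕ suc j ⊛ P ≡ Q ⊕ 2 * suc j ⊛ translate P →
    horner Q 0 ≡ 2 * suc j * horner P 0 →
    ClosedColumn a (suc j) Q
  closedColumn-suc {j} {P} {Q} (closedColumn column) shift base = closedColumn next
    where
    next : ∀ c → suc j ! * a c (suc j) ≡ 2 ^ c * horner Q c
    next zero    = column-induction-base {m = suc j} {K = j !} (table-edgeʳ table j) (column 0) base
    next (suc c) = column-induction-step {m = suc j} {K = j !} {e = 2 ^ c}
      (table-local table c j) (column c) (next c) (column (suc c)) (translation-identity {suc j} {P} {Q} shift c)

  column₁ : ClosedColumn a 1 e₁
  column₁ = closedColumn-suc closedColumn-zero refl refl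

  column₂ : ClosedColumn a 2 e₂
  column₂ = closedColumn-suc column₁ refl refl

  column₃ : ClosedColumn a 3 e₃
  column₃ = closedColumn-suc column₂ refl refl

  column₄ : ClosedColumn a 4 e₄
  column₄ = closedColumn-suc column₃ refl refl

  column₅ : ClosedColumn a 5 e₅
  column₅ = closedColumn-suc column₄ refl refl

a₃ b₃ a₅ b₅ s₅ : List ℕ
a₃ = 4 ∷ 1 ∷ []
b₃ = 12 ∷ 11 ∷ 1 ∷ []
a₅ = 6 ∷ 1 ∷ []
b₅ = 640 ∷ 914 ∷ 331 ∷ 34 ∷ 1 ∷ []
s₅ = 0 ∷ 163 ∷ 28 ∷ 1 ∷ []

e₃-factorisation : ∀ x → horner e₃ x ≡ horner a₃ x * horner b₃ x
e₃-factorisation x = trans (horner-cong {e₃} {a₃ ⊗ b₃} refl x) (horner-⊗ a₃ b₃ x)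

e₅-factorisation : ∀ x → horner e₅ x ≡ horner a₅ x * horner b₅ x
e₅-factorisation x = trans (horner-cong {e₅} {a₅ ⊗ b₅} refl x) (horner-⊗ a₅ b₅ x)

a₃-b₃-relation : ∀ x → horner a₃ x * horner (7 ∷ 1 ∷ []) x ≡ horner b₃ x + 16
a₃-b₃-relation x = begin
  horner a₃ x * horner (7 ∷ 1 ∷ []) x   ≡⟨ horner-⊗ a₃ (7 ∷ 1 ∷ []) x ⟨
  horner (a₃ ⊗ (7 ∷ 1 ∷ [])) x           ≡⟨ horner-cong {a₃ ⊗ (7 ∷ 1 ∷ [])} {b₃ ⊕ (16 ∷ [])} refl x ⟩
  horner (b₃ ⊕ (16 ∷ [])) x              ≡⟨ horner-⊕ b₃ (16 ∷ []) x ⟩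
  horner b₃ x + horner (16 ∷ []) x       ≡⟨ cong (horner b₃ x +_) (horner-constant 16 x) ⟩
  horner b₃ x + 16                       ∎
  where open ≡-Reasoning

a₅-b₅-relation : ∀ x → horner a₅ x * horner s₅ x + 1024 ≡ horner b₅ x + 64 * horner a₅ x
a₅-b₅-relation x = begin
  horner a₅ x * horner s₅ x + 1024            ≡⟨ cong₂ _+_ (horner-⊗ a₅ s₅ x) (horner-constant 1024 x) ⟨
  horner (a₅ ⊗ s₅) x + horner (1024 ∷ []) x   ≡⟨ horner-⊕ (a₅ ⊗ s₅) (1024 ∷ []) x ⟨
  horner (a₅ ⊗ s₅ ⊕ (1024 ∷ [])) x            ≡⟨ horner-cong {a₅ ⊗ s₅ ⊕ (1024 ∷ [])} {b₅ ⊕ 64 ⊛ a₅} refl x ⟩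
  horner (b₅ ⊕ 64 ⊛ a₅) x                     ≡⟨ horner-⊕ b₅ (64 ⊛ a₅) x ⟩
  horner b₅ x + horner (64 ⊛ a₅) x            ≡⟨ cong (horner b₅ x +_) (horner-⊛ 64 a₅ x) ⟩
  horner b₅ x + 64 * horner a₅ x              ∎
  where open ≡-Reasoning

-- The two implicit arguments are closed decisions, discharged by evaluation at each use.
no-odd-solution-below : ∀ M k P C Q →
  {True (allUpTo? (λ c → allUpTo? (λ q → (M * q ^ k ≟ horner P c) →-dec (q ≟ 2)) Q) (suc C))} →
  {True (horner P C <? M * Q ^ k)} →
  ∀ {c q} → c ≤ C → M * q ^ k ≡ horner P c → q ≡ 2
no-odd-solution-below M k P C Q {checked} {bounded} {c} {q} c≤C eq with q <? Q
... | yes q<Q = toWitness checked (s≤s c≤C) q<Q eq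
... | no q≮Q = contradiction (toWitness bounded) (≤⇒≯ (begin
  M * Q ^ k   ≤⟨ *-monoʳ-≤ M (^-monoˡ-≤ k (≮⇒≥ q≮Q)) ⟩
  M * q ^ k   ≡⟨ eq ⟩
  horner P c  ≤⟨ horner-mono P c≤C ⟩
  horner P C  ∎))
  where open ≤-Reasoning

no-odd-solution₃ : ∀ {c q} → c ≤ 2 → 3 ! * q ^ 3 ≡ horner e₃ c → q ≡ 2
no-odd-solution₃ = no-odd-solution-below (3 !) 3 e₃ 2 4

no-odd-solution₅ : ∀ {c q} → c ≤ 114 → 5 ! * q ^ 5 ≡ horner e₅ c → q ≡ 2
no-odd-solution₅ = no-odd-solution-below (5 !) 5 e₅ 114 51

pristine⇒equation : ∀ {q k P} c → ClosedColumn (λ i j → recDiv (2 ^ i * q ^ j)) k P →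
  Pristine (2 ^ c * q ^ k) → k ! * q ^ k ≡ horner P c
pristine⇒equation {q} {k} {P} c column pristine = *-cancelˡ-≡ _ _ (2 ^ c) {{m^n≢0 2 c}} (begin
  2 ^ c * (k ! * q ^ k)          ≡⟨ x∙yz≈y∙xz (2 ^ c) (k !) (q ^ k) ⟩
  k ! * (2 ^ c * q ^ k)          ≡⟨ cong (k ! *_) pristine ⟨
  k ! * recDiv (2 ^ c * q ^ k)   ≡⟨ closed column c ⟩
  2 ^ c * horner P c             ∎)
  where open ≡-Reasoning

module _ {q : ℕ} (q-prime : Prime q) (q≢2 : q ≢ 2) where

  private
    table : RecDivTable (λ i j → recDiv (2 ^ i * q ^ j))
    table = recDiv-p^*q^-table prime[2] q-prime (q≢2 ∘ sym)

  q∤2^ : ∀ n → ¬ q ∣ 2 ^ n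
  q∤2^ n q∣2^n = q≢2 (∣prime^⇒≡ q-prime n prime[2] q∣2^n)

  ¬pristine-2^c*q^3 : ∀ c → ¬ Pristine (2 ^ c * q ^ 3)
  ¬pristine-2^c*q^3 c pristine = q≢2 (no-odd-solution₃ c≤2 equation)
    where
    equation : 3 ! * q ^ 3 ≡ horner e₃ c
    equation = pristine⇒equation c (column₃ table) pristine
    not-both : q ∣ horner a₃ c → q ∣ horner b₃ c → ⊥
    not-both q∣A q∣B =
      q∤2^ 4 (∣m+n∣m⇒∣n (subst (q ∣_) (a₃-b₃-relation c) (∣m⇒∣m*n (horner (7 ∷ 1 ∷ []) c) q∣A)) q∣B)
    c≤2 : c ≤ 2
    c≤2 = +-cancelˡ-≤ 4 c 2 (subst (_≤ 6) (horner-linear 4 c)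
      (factor≤ q-prime (3 !) 3 (horner a₃ c) (horner b₃ c) (trans equation (e₃-factorisation c)) (m≤m+n 7 _) z<s not-both))

  ¬pristine-2^c*q^5 : ∀ c → ¬ Pristine (2 ^ c * q ^ 5)
  ¬pristine-2^c*q^5 c pristine = q≢2 (no-odd-solution₅ c≤114 equation)
    where
    equation : 5 ! * q ^ 5 ≡ horner e₅ c
    equation = pristine⇒equation c (column₅ table) pristine
    not-both : q ∣ horner a₅ c → q ∣ horner b₅ c → ⊥
    not-both q∣A q∣B = q∤2^ 10 (∣m+n∣m⇒∣n
      (subst (q ∣_) (sym (a₅-b₅-relation c)) (∣m∣n⇒∣m+n q∣B (∣n⇒∣m*n 64 q∣A)))
      (∣m⇒∣m*n (horner s₅ c) q∣A))
    c≤114 : c ≤ 114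
    c≤114 = +-cancelˡ-≤ 6 c 114 (subst (_≤ 120) (horner-linear 6 c)
      (factor≤ q-prime (5 !) 5 (horner a₅ c) (horner b₅ c) (trans equation (e₅-factorisation c)) (m≤m+n 121 _) z<s not-both))

theorem5 : (q c : ℕ) → Prime q → q ≢ 2 →
    ¬ Pristine (2 ^ c * q ^ 3) × ¬ Pristine (2 ^ c * q ^ 5)
theorem5 q c q-prime q≢2 = ¬pristine-2^c*q^3 q-prime q≢2 c , ¬pristine-2^c*q^5 q-prime q≢2 c
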